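{- Let $q$ be a prime power, $E\subseteq\mathbb{F}_q^2$, and let $\Theta\subseteq\mathbb{F}_q$ be nonempty. Then there exists $\theta\in\Theta$ such that \[ |E\cdot(1,\theta)|\ge q\,\frac{|E||\Theta|}{q^2+|E||\Theta|}. \] In particular, if $|E||\Theta|>q^2$, then there exists $\theta\in\Theta$ such that $|E\cdot(1,\theta)|>q/2$.
   Context: For $E\subseteq\mathbb{F}_q^2$ and $v\in\mathbb{F}_q^2$, $E\cdot v=\{u\cdot v: u\in E\}\subseteq\mathbb{F}_q$, where $u\cdot v=u_1v_1+u_2v_2$. -}

module Defs where

open import Level using (0ℓ)
open import Data.Nat using (ℕ)
open import Data.Fin using (Fin)
open import Data.Product using (_×_; proj₁; proj₂)
open import Data.List using (List; map; filter; length; allFin)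
open import Data.List.Relation.Unary.Any using (any?)
open import Relation.Nullary using (¬_)
open import Relation.Binary.PropositionalEquality using (_≡_)
open import Relation.Binary.Definitions using (DecidableEquality)
open import Algebra.Structures using (IsCommutativeRing)
open import Function.Bundles using (_↔_; Inverse)
open import Data.Product using (∃)

-- A finite field with exactly q elements (q is then necessarily a prime
-- power, and every prime power arises this way; F_q is unique up to iso).
record FiniteField : Set₁ where
  infixl 6 _+_
  infixl 7 _*_
  field
    F     : Set
    _+_   : F → F → F
    _*_   : F → F → F
    -_    : F → F
    0#    : F
    1#    : F
    isCommutativeRing : IsCommutativeRing _≡_ _+_ _*_ -_ 0# 1#
    0≢1   : ¬ (0# ≡ 1#)
    inverse : ∀ x → ¬ (x ≡ 0#) → ∃ λ y → x * y ≡ 1#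
    _≟_   : DecidableEquality F
    q     : ℕ
    enum  : Fin q ↔ F

  elements : List F
  elements = map (Inverse.to enum) (allFin q)

  _·_ : F × F → F × F → F
  u · v = proj₁ u * proj₁ v + proj₂ u * proj₂ v

  dotCard : List (F × F) → F × F → ℕ
  dotCard E v = length (filter (λ c → any? (λ u → (u · v) ≟ c) E) elements)

module Submission where

-- For v ∈ F_q² let r_v(c) = #{u ∈ E : u · v = c}; its energy Σ_c r_v(c)² counts the pairs
-- (u, u′) ∈ E² with u · v = u′ · v. Cauchy–Schwarz gives |E|² ≤ |E · v| · energy(v) and
-- |E|² ≤ q · energy(v). Two distinct points have equal dot product with (1, θ) for at most one θ,
-- so Σ_{θ ∈ F_q} energy(1, θ) ≤ |E| (q + |E|); since every term is at least |E|²/q, the sum over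
-- Θ alone is at most q |E| + |Θ| |E|²/q. The θ ∈ Θ of least energy thus has
-- q |Θ| energy(1, θ) ≤ q² |E| + |Θ| |E|², and the first Cauchy–Schwarz bound turns this into the claim.

open import Defs
open import Algebra.Bundles using (CommutativeRing)
import Algebra.Properties.Group as GroupProperties
import Algebra.Properties.Ring as RingProperties
open import Data.Product using (_×_; _,_; ∃)
open import Data.Empty using (⊥-elim)
open import Relation.Nullary using (¬_; yes; no; contradiction)
open import Relation.Binary.PropositionalEquality

module Collisions (𝔽 : FiniteField) where
  open FiniteField 𝔽 using (F; isCommutativeRing; inverse; _≟_; _·_)

  commutativeRing : CommutativeRing _ _
  commutativeRing = record { isCommutativeRing = isCommutativeRing }

  open CommutativeRing commutativeRing
    using (_+_; _*_; -_; _-_; 0#; 1#; +-comm; +-assoc; *-assoc; *-comm; *-identityˡ; *-identityʳ; zeroˡ; +-group; ring)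
  open GroupProperties +-group using (x∙y⁻¹≈ε⇒x≈y; \\-leftDividesʳ; //-rightDividesʳ; x≈y⇒x∙y⁻¹≈ε)
  open RingProperties ring using ([y-z]x≈yx-zx)
  open ≡-Reasoning

  *-cancelˡ : ∀ b {x y} → ¬ b ≡ 0# → b * x ≡ b * y → x ≡ y
  *-cancelˡ b {x} {y} b≢0 bx≡by with inverse b b≢0
  ... | b⁻¹ , bb⁻¹≡1 = begin
    x              ≡⟨ unscale x ⟩
    b⁻¹ * (b * x)  ≡⟨ cong (b⁻¹ *_) bx≡by ⟩
    b⁻¹ * (b * y)  ≡⟨ unscale y ⟨
    y              ∎
    where
    unscale : ∀ z → z ≡ b⁻¹ * (b * z)
    unscale z = begin
      z              ≡⟨ *-identityˡ z ⟨
      1# * z         ≡⟨ cong (_* z) (trans (sym bb⁻¹≡1) (*-comm b b⁻¹)) ⟩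
      b⁻¹ * b * z    ≡⟨ *-assoc b⁻¹ b z ⟩
      b⁻¹ * (b * z)  ∎

  a+p≡a′+r⇒p-r≡a′-a : ∀ {a a′ p r} → a + p ≡ a′ + r → p - r ≡ a′ - a
  a+p≡a′+r⇒p-r≡a′-a {a} {a′} {p} {r} e = begin
    p - r                ≡⟨ cong (_- r) (\\-leftDividesʳ a p) ⟨
    (- a + (a + p)) - r  ≡⟨ cong (λ z → (- a + z) - r) e ⟩
    (- a + (a′ + r)) - r ≡⟨ cong (_- r) (+-assoc (- a) a′ r) ⟨
    (- a + a′ + r) - r   ≡⟨ //-rightDividesʳ r (- a + a′) ⟩
    - a + a′             ≡⟨ +-comm (- a) a′ ⟩
    a′ - a               ∎

  slope-difference : ∀ a b a′ b′ t → (a , b) · (1# , t) ≡ (a′ , b′) · (1# , t) → (b - b′) * t ≡ a′ - a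
  slope-difference a b a′ b′ t e = begin
    (b - b′) * t       ≡⟨ [y-z]x≈yx-zx t b b′ ⟩
    b * t - b′ * t     ≡⟨ a+p≡a′+r⇒p-r≡a′-a e ⟩
    a′ * 1# - a * 1#   ≡⟨ cong₂ (λ x y → x - y) (*-identityʳ a′) (*-identityʳ a) ⟩
    a′ - a             ∎

  collision-unique : ∀ (u u′ : F × F) {θ θ′} → ¬ u ≡ u′ →
    u · (1# , θ) ≡ u′ · (1# , θ) → u · (1# , θ′) ≡ u′ · (1# , θ′) → θ ≡ θ′
  collision-unique (a , b) (a′ , b′) {θ} {θ′} u≢u′ e e′ with b ≟ b′
  ... | no b≢b′ = *-cancelˡ (b - b′) (λ b-b′≡0 → b≢b′ (x∙y⁻¹≈ε⇒x≈y b b′ b-b′≡0))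
        (trans (slope-difference a b a′ b′ θ e) (sym (slope-difference a b a′ b′ θ′ e′)))
  ... | yes refl = ⊥-elim (u≢u′ (cong (_, b) (sym (x∙y⁻¹≈ε⇒x≈y a′ a a′-a≡0))))
    where
    a′-a≡0 : a′ - a ≡ 0#
    a′-a≡0 = begin
      a′ - a        ≡⟨ slope-difference a b a′ b θ e ⟨
      (b - b) * θ   ≡⟨ cong (_* θ) (x≈y⇒x∙y⁻¹≈ε refl) ⟩
      0# * θ        ≡⟨ zeroˡ θ ⟩
      0#            ∎

open import Data.Nat using (ℕ; zero; suc; _+_; _*_; _^_; _≤_; _<_; _≥_; _>_; z≤n; s≤s; NonZero; >-nonZero)
open import Data.Nat.Properties hiding (_≟_)
open import Data.Nat.Tactic.RingSolver using (solve-∀)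
import Data.Nat as ℕ
open import Data.Product.Properties using (≡-dec)
open import Data.Sum using (inj₁; inj₂; [_,_]′)
open import Data.Fin.Properties using (toℕ<n)
open import Data.List using (List; []; _∷_; length; filter; allFin)
open import Data.List.Properties using (length-map; length-tabulate)
import Data.List.Extrema.Nat as Extrema
open import Data.List.Relation.Unary.All as All using (All; []; _∷_)
open import Data.List.Relation.Unary.All.Properties using (¬Any⇒All¬)
open import Data.List.Relation.Unary.Any using (Any; any?; here; there)
open import Data.List.Relation.Unary.AllPairs using (_∷_)
open import Data.List.Membership.Propositional using (_∈_)
open import Data.List.Membership.Propositional.Properties using (∈-map⁺; ∈-allFin)
open import Data.List.Relation.Unary.Unique.Propositional using (Unique)
open import Data.List.Relation.Unary.Unique.Propositional.Properties using (map⁺; allFin⁺)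
open import Function using (id)
open import Function.Bundles using (Inverse; Injection)
open import Function.Properties.Inverse using (Inverse⇒Injection)
open import Relation.Unary using (Pred; Decidable)
open import Relation.Binary.Definitions using (DecidableEquality)

∑ : {A : Set} → List A → (A → ℕ) → ℕ
∑ []       f = 0
∑ (x ∷ xs) f = f x + ∑ xs f

syntax ∑ L (λ x → e) = ∑[ x ∈ L ] e

module _ {A : Set} where

  ∑-cong : ∀ (L : List A) {f g : A → ℕ} → (∀ x → f x ≡ g x) → ∑ L f ≡ ∑ L g
  ∑-cong []       f≗g = refl
  ∑-cong (x ∷ xs) f≗g = cong₂ _+_ (f≗g x) (∑-cong xs f≗g)

  ∑-mono : ∀ (L : List A) {f g : A → ℕ} → (∀ x → x ∈ L → f x ≤ g x) → ∑ L f ≤ ∑ L g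
  ∑-mono []       f≤g = z≤n
  ∑-mono (x ∷ xs) f≤g = +-mono-≤ (f≤g x (here refl)) (∑-mono xs (λ y y∈xs → f≤g y (there y∈xs)))

  ∑-+ : ∀ (L : List A) (f g : A → ℕ) → ∑[ x ∈ L ] (f x + g x) ≡ ∑ L f + ∑ L g
  ∑-+ []       f g = refl
  ∑-+ (x ∷ xs) f g = trans (cong (f x + g x +_) (∑-+ xs f g)) (+-+-comm (f x) (g x) (∑ xs f) (∑ xs g))
    where
    +-+-comm : ∀ a b c d → a + b + (c + d) ≡ a + c + (b + d)
    +-+-comm = solve-∀

  ∑-*ˡ : ∀ (L : List A) (f : A → ℕ) k → ∑[ x ∈ L ] (k * f x) ≡ k * ∑ L f
  ∑-*ˡ []       f k = sym (*-zeroʳ k)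
  ∑-*ˡ (x ∷ xs) f k = trans (cong (k * f x +_) (∑-*ˡ xs f k)) (sym (*-distribˡ-+ k (f x) (∑ xs f)))

  ∑-*ʳ : ∀ (L : List A) (f : A → ℕ) k → ∑[ x ∈ L ] (f x * k) ≡ ∑ L f * k
  ∑-*ʳ []       f k = refl
  ∑-*ʳ (x ∷ xs) f k = trans (cong (f x * k +_) (∑-*ʳ xs f k)) (sym (*-distribʳ-+ k (f x) (∑ xs f)))

  ∑-const : ∀ (L : List A) k → ∑[ x ∈ L ] k ≡ length L * k
  ∑-const []       k = refl
  ∑-const (x ∷ xs) k = cong (k +_) (∑-const xs k)

  ∑-zero : ∀ (L : List A) {f : A → ℕ} → All (λ x → f x ≡ 0) L → ∑ L f ≡ 0
  ∑-zero []       []           = refl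
  ∑-zero (x ∷ xs) (fx≡0 ∷ fxs≡0) = cong₂ _+_ fx≡0 (∑-zero xs fxs≡0)

  ∑-filter : ∀ {ℓ} {P : Pred A ℓ} (P? : Decidable P) (L : List A) {f : A → ℕ} →
             (∀ x → ¬ P x → f x ≡ 0) → ∑ (filter P? L) f ≡ ∑ L f
  ∑-filter P? []       f-vanishes = refl
  ∑-filter P? (x ∷ xs) {f} f-vanishes with P? x
  ... | yes _  = cong (f x +_) (∑-filter P? xs f-vanishes)
  ... | no ¬px = trans (∑-filter P? xs f-vanishes) (cong (_+ ∑ xs f) (sym (f-vanishes x ¬px)))

  ∑-≤1 : ∀ (L : List A) {f : A → ℕ} → Unique L → (∀ x → f x ≤ 1) →
         (∀ x y → ¬ f x ≡ 0 → ¬ f y ≡ 0 → x ≡ y) → ∑ L f ≤ 1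
  ∑-≤1 []       _            f≤1 support = z≤n
  ∑-≤1 (x ∷ xs) {f} (x∉xs ∷ xs-unique) f≤1 support with f x ℕ.≟ 0
  ... | yes fx≡0 rewrite fx≡0 = ∑-≤1 xs xs-unique f≤1 support
  ... | no fx≢0 = begin
    f x + ∑ xs f ≡⟨ cong (f x +_) (∑-zero xs (All.map vanishes x∉xs)) ⟩
    f x + 0      ≡⟨ +-identityʳ (f x) ⟩
    f x          ≤⟨ f≤1 x ⟩
    1            ∎
    where
    open ≤-Reasoning
    vanishes : ∀ {y} → ¬ x ≡ y → f y ≡ 0
    vanishes {y} x≢y with f y ℕ.≟ 0
    ... | yes fy≡0 = fy≡0
    ... | no fy≢0  = ⊥-elim (x≢y (support x y fx≢0 fy≢0))

  ∃-below-average : ∀ (L : List A) (f : A → ℕ) → ¬ L ≡ [] → ∃ λ x → x ∈ L × length L * f x ≤ ∑ L f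
  ∃-below-average []       f L≢[] = ⊥-elim (L≢[] refl)
  ∃-below-average L@(x ∷ xs) f _ = m , m∈L , (begin
    length L * f m   ≡⟨ ∑-const L (f m) ⟨
    ∑[ y ∈ L ] f m   ≤⟨ ∑-mono L m-minimal ⟩
    ∑ L f            ∎)
    where
    open ≤-Reasoning
    open Extrema using (argmin; argmin-sel; f[argmin]≤f[⊤]; f[argmin]≤f[xs])
    m : A
    m = argmin f x xs
    m∈L : m ∈ L
    m∈L with argmin-sel f x xs
    ... | inj₁ m≡x   = here m≡x
    ... | inj₂ m∈xs  = there m∈xs
    m-minimal : ∀ y → y ∈ L → f m ≤ f y
    m-minimal y (here refl)  = f[argmin]≤f[⊤] {f = f} x xs
    m-minimal y (there y∈xs) = All.lookup (f[argmin]≤f[xs] {f = f} x xs) y∈xs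

module _ {B C : Set} where

  ∑-swap : ∀ (L : List B) (K : List C) (f : B → C → ℕ) →
           ∑[ x ∈ L ] ∑[ y ∈ K ] f x y ≡ ∑[ y ∈ K ] ∑[ x ∈ L ] f x y
  ∑-swap []       K f = sym (trans (∑-const K 0) (*-zeroʳ (length K)))
  ∑-swap (x ∷ xs) K f = trans (cong (∑ K (f x) +_) (∑-swap xs K f)) (sym (∑-+ K (f x) (λ y → ∑[ x′ ∈ xs ] f x′ y)))

  ∑-*-∑ : ∀ (L : List B) (K : List C) (f : B → ℕ) (g : C → ℕ) →
          ∑ L f * ∑ K g ≡ ∑[ x ∈ L ] ∑[ y ∈ K ] (f x * g y)
  ∑-*-∑ L K f g = trans (sym (∑-*ʳ L f (∑ K g))) (∑-cong L (λ x → sym (∑-*ˡ K g (f x))))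

2xy≤x²+y² : ∀ x y → 2 * (x * y) ≤ x * x + y * y
2xy≤x²+y² x y = [ ordered , swapped ]′ (≤-total x y)
  where
  ordered : ∀ {x y} → x ≤ y → 2 * (x * y) ≤ x * x + y * y
  ordered {x} x≤y with d , refl ← m≤n⇒∃[o]m+o≡n x≤y =
    subst (2 * (x * (x + d)) ≤_) (square-gap x d) (m≤m+n _ (d * d))
    where
    square-gap : ∀ x d → 2 * (x * (x + d)) + d * d ≡ x * x + (x + d) * (x + d)
    square-gap = solve-∀
  swapped : y ≤ x → 2 * (x * y) ≤ x * x + y * y
  swapped y≤x = subst₂ (λ a b → 2 * a ≤ b) (*-comm y x) (+-comm (y * y) (x * x)) (ordered y≤x)

cauchy-schwarz : ∀ {A : Set} (L : List A) (f : A → ℕ) → ∑ L f * ∑ L f ≤ length L * ∑[ x ∈ L ] (f x * f x)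
cauchy-schwarz L f = *-cancelˡ-≤ 2 (begin
  2 * (∑ L f * ∑ L f)                                ≡⟨ cong (2 *_) (∑-*-∑ L L f f) ⟩
  2 * ∑[ x ∈ L ] ∑[ y ∈ L ] (f x * f y)              ≡⟨ double-∑-*ˡ ⟨
  ∑[ x ∈ L ] ∑[ y ∈ L ] (2 * (f x * f y))            ≤⟨ ∑-mono L (λ x _ → ∑-mono L (λ y _ → 2xy≤x²+y² (f x) (f y))) ⟩
  ∑[ x ∈ L ] ∑[ y ∈ L ] (f x * f x + f y * f y)      ≡⟨ ∑-cong L (λ x → trans (∑-+ L _ _) (cong (_+ Q) (∑-const L _))) ⟩
  ∑[ x ∈ L ] (n * (f x * f x) + Q)                   ≡⟨ ∑-+ L _ _ ⟩
  ∑[ x ∈ L ] (n * (f x * f x)) + ∑[ x ∈ L ] Q        ≡⟨ cong₂ _+_ (∑-*ˡ L _ n) (∑-const L Q) ⟩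
  n * Q + n * Q                                      ≡⟨ cong (n * Q +_) (+-identityʳ (n * Q)) ⟨
  2 * (n * Q)                                        ∎)
  where
  open ≤-Reasoning
  n : ℕ
  n = length L
  Q : ℕ
  Q = ∑[ x ∈ L ] (f x * f x)
  double-∑-*ˡ : ∑[ x ∈ L ] ∑[ y ∈ L ] (2 * (f x * f y)) ≡ 2 * ∑[ x ∈ L ] ∑[ y ∈ L ] (f x * f y)
  double-∑-*ˡ = trans (∑-cong L (λ x → ∑-*ˡ L _ 2)) (∑-*ˡ L _ 2)

module Indicator {A : Set} (_≟_ : DecidableEquality A) where

  δ : A → A → ℕ
  δ x y with x ≟ y
  ... | yes _ = 1
  ... | no _  = 0

  δ≤1 : ∀ x y → δ x y ≤ 1
  δ≤1 x y with x ≟ y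
  ... | yes _ = s≤s z≤n
  ... | no _  = z≤n

  δ≢0⇒≡ : ∀ {x y} → ¬ δ x y ≡ 0 → x ≡ y
  δ≢0⇒≡ {x} {y} δ≢0 with x ≟ y
  ... | yes x≡y = x≡y
  ... | no _    = ⊥-elim (δ≢0 refl)

  ≢⇒δ≡0 : ∀ {x y} → ¬ x ≡ y → δ x y ≡ 0
  ≢⇒δ≡0 {x} {y} x≢y with x ≟ y
  ... | yes x≡y = ⊥-elim (x≢y x≡y)
  ... | no _    = refl

  ∑-δ≤1 : ∀ (L : List A) y → Unique L → ∑[ x ∈ L ] δ x y ≤ 1
  ∑-δ≤1 L y L-unique = ∑-≤1 L L-unique (λ x → δ≤1 x y) (λ x x′ δ≢0 δ′≢0 → trans (δ≢0⇒≡ δ≢0) (sym (δ≢0⇒≡ δ′≢0)))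

  ∑-δ-sift : ∀ (L : List A) {x} (h : A → ℕ) → Unique L → x ∈ L → ∑[ y ∈ L ] (δ x y * h y) ≡ h x
  ∑-δ-sift (y ∷ L) {x} h (y∉L ∷ L-unique) x∈y∷L with x ≟ y | x∈y∷L
  ... | yes refl | _        = trans (cong (h x + 0 +_) (∑-zero L (All.map (λ x≢z → cong (_* _) (≢⇒δ≡0 x≢z)) y∉L)))
                                    (trans (+-identityʳ _) (+-identityʳ _))
  ... | no x≢y  | here x≡y  = ⊥-elim (x≢y x≡y)
  ... | no _    | there x∈L = ∑-δ-sift L h L-unique x∈L

module Enumeration {A : Set} (_≟_ : DecidableEquality A)
                   (L : List A) (L-unique : Unique L) (L-complete : ∀ x → x ∈ L) where

  open Indicator _≟_

  ∑-fibres : ∀ {B : Set} (K : List B) (k : B → A) → ∑[ c ∈ L ] ∑[ y ∈ K ] δ (k y) c ≡ length K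
  ∑-fibres K k = begin
    ∑[ c ∈ L ] ∑[ y ∈ K ] δ (k y) c   ≡⟨ ∑-swap K L _ ⟨
    ∑[ y ∈ K ] ∑[ c ∈ L ] δ (k y) c   ≡⟨ ∑-cong K fibre≡1 ⟩
    ∑[ y ∈ K ] 1                      ≡⟨ ∑-const K 1 ⟩
    length K * 1                      ≡⟨ *-identityʳ (length K) ⟩
    length K                          ∎
    where
    open ≡-Reasoning
    fibre≡1 : ∀ y → ∑[ c ∈ L ] δ (k y) c ≡ 1
    fibre≡1 y = trans (∑-cong L (λ c → sym (*-identityʳ (δ (k y) c)))) (∑-δ-sift L (λ _ → 1) L-unique (L-complete (k y)))

  ∑-sublist+≤ : ∀ (Θ : List A) → Unique Θ → (f : A → ℕ) (m : ℕ) → (∀ x → m ≤ f x) →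
                ∑ Θ f + length L * m ≤ ∑ L f + length Θ * m
  ∑-sublist+≤ Θ Θ-unique f m m≤f = begin
    ∑ Θ f + length L * m                            ≡⟨ cong₂ _+_ ∑Θ-as-∑L (∑-const L m) ⟨
    ∑[ c ∈ L ] (count c * f c) + ∑[ c ∈ L ] m        ≡⟨ ∑-+ L _ _ ⟨
    ∑[ c ∈ L ] (count c * f c + m)                  ≤⟨ ∑-mono L (λ c _ → exchange (∑-δ≤1 Θ c Θ-unique) (m≤f c)) ⟩
    ∑[ c ∈ L ] (f c + count c * m)                  ≡⟨ ∑-+ L _ _ ⟩
    ∑ L f + ∑[ c ∈ L ] (count c * m)                ≡⟨ cong (∑ L f +_) (∑-*ʳ L count m) ⟩
    ∑ L f + ∑ L count * m                           ≡⟨ cong (λ t → ∑ L f + t * m) (∑-fibres Θ id) ⟩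
    ∑ L f + length Θ * m                            ∎
    where
    open ≤-Reasoning
    count : A → ℕ
    count c = ∑[ θ ∈ Θ ] δ θ c
    ∑Θ-as-∑L : ∑[ c ∈ L ] (count c * f c) ≡ ∑ Θ f
    ∑Θ-as-∑L = begin-equality
      ∑[ c ∈ L ] (count c * f c)              ≡⟨ ∑-cong L (λ c → ∑-*ʳ Θ (λ θ → δ θ c) (f c)) ⟨
      ∑[ c ∈ L ] ∑[ θ ∈ Θ ] (δ θ c * f c)      ≡⟨ ∑-swap L Θ _ ⟩
      ∑[ θ ∈ Θ ] ∑[ c ∈ L ] (δ θ c * f c)      ≡⟨ ∑-cong Θ (λ θ → ∑-δ-sift L f L-unique (L-complete θ)) ⟩
      ∑ Θ f                                   ∎
    exchange : ∀ {k X Y} → k ≤ 1 → Y ≤ X → k * X + Y ≤ X + k * Y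
    exchange {zero}        {X}     _        Y≤X = ≤-trans Y≤X (m≤m+n X 0)
    exchange {suc zero}    {X} {Y} _        _   = ≤-reflexive (cong₂ _+_ (+-identityʳ X) (sym (+-identityʳ Y)))
    exchange {suc (suc _)}         (s≤s ()) _

module Elements (𝔽 : FiniteField) where
  open FiniteField 𝔽 using (0#; q; enum; elements)

  elements-unique : Unique elements
  elements-unique = map⁺ (Injection.injective (Inverse⇒Injection enum)) (allFin⁺ q)

  ∈-elements : ∀ x → x ∈ elements
  ∈-elements x = subst (_∈ elements) (Inverse.strictlyInverseˡ enum x) (∈-map⁺ (Inverse.to enum) (∈-allFin (Inverse.from enum x)))

  length-elements : length elements ≡ q
  length-elements = trans (length-map _ (allFin q)) (length-tabulate id)

  q-nonZero : NonZero q
  q-nonZero = >-nonZero (≤-<-trans z≤n (toℕ<n (Inverse.from enum 0#)))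

module Energy (𝔽 : FiniteField) (E : List (FiniteField.F 𝔽 × FiniteField.F 𝔽)) (E-unique : Unique E) where
  open FiniteField 𝔽 using (F; 1#; _·_; _≟_; elements; q; dotCard)
  open Elements 𝔽
  open Collisions 𝔽 using (collision-unique)
  open Indicator _≟_
  open Enumeration _≟_ elements elements-unique ∈-elements
  module Points = Indicator (≡-dec _≟_ _≟_)

  reps : F × F → F → ℕ
  reps v c = ∑[ u ∈ E ] δ (u · v) c

  energy : F × F → ℕ
  energy v = ∑[ c ∈ elements ] (reps v c * reps v c)

  ∑-reps : ∀ v → ∑[ c ∈ elements ] reps v c ≡ length E
  ∑-reps v = ∑-fibres E (_· v)

  energy≡∑-reps : ∀ v → energy v ≡ ∑[ u ∈ E ] reps v (u · v)
  energy≡∑-reps v = begin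
    ∑[ c ∈ elements ] (reps v c * reps v c)              ≡⟨ ∑-cong elements (λ c → ∑-*ʳ E _ (reps v c)) ⟨
    ∑[ c ∈ elements ] ∑[ u ∈ E ] (δ (u · v) c * reps v c) ≡⟨ ∑-swap E elements _ ⟨
    ∑[ u ∈ E ] ∑[ c ∈ elements ] (δ (u · v) c * reps v c) ≡⟨ ∑-cong E (λ u → ∑-δ-sift elements (reps v) elements-unique (∈-elements (u · v))) ⟩
    ∑[ u ∈ E ] reps v (u · v)                            ∎
    where open ≡-Reasoning

  |E|²≤q*energy : ∀ v → length E * length E ≤ q * energy v
  |E|²≤q*energy v = subst₂ (λ a b → a * a ≤ b * energy v) (∑-reps v) length-elements (cauchy-schwarz elements (reps v))

  |E|²≤dotCard*energy : ∀ v → length E * length E ≤ dotCard E v * energy v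
  |E|²≤dotCard*energy v = subst₂ (λ a b → a * a ≤ dotCard E v * b) ∑-support-reps ∑-support-reps² (cauchy-schwarz support (reps v))
    where
    attained? : Decidable (λ c → Any (λ u → u · v ≡ c) E)
    attained? c = any? (λ u → (u · v) ≟ c) E
    support : List F
    support = filter attained? elements
    reps-vanish : ∀ c → ¬ Any (λ u → u · v ≡ c) E → reps v c ≡ 0
    reps-vanish c c∉E·v = ∑-zero E (All.map ≢⇒δ≡0 (¬Any⇒All¬ E c∉E·v))
    ∑-support-reps : ∑ support (reps v) ≡ length E
    ∑-support-reps = trans (∑-filter attained? elements reps-vanish) (∑-reps v)
    ∑-support-reps² : ∑[ c ∈ support ] (reps v c * reps v c) ≡ energy v
    ∑-support-reps² = ∑-filter attained? elements (λ c c∉E·v → cong (λ r → r * r) (reps-vanish c c∉E·v))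

  collisions : F × F → F × F → ℕ
  collisions u u′ = ∑[ θ ∈ elements ] δ (u′ · (1# , θ)) (u · (1# , θ))

  collisions≤ : ∀ u u′ → collisions u u′ ≤ q * Points.δ u′ u + 1
  collisions≤ u u′ with ≡-dec _≟_ _≟_ u′ u
  ... | yes _ = begin
    collisions u u′           ≤⟨ ∑-mono elements (λ θ _ → δ≤1 _ _) ⟩
    ∑[ θ ∈ elements ] 1       ≡⟨ ∑-const elements 1 ⟩
    length elements * 1       ≡⟨ cong (_* 1) length-elements ⟩
    q * 1                     ≤⟨ m≤m+n (q * 1) 1 ⟩
    q * 1 + 1                 ∎
    where open ≤-Reasoning
  ... | no u′≢u = begin
    collisions u u′           ≤⟨ ∑-≤1 elements elements-unique (λ θ → δ≤1 _ _) same-θ ⟩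
    1                         ≡⟨ cong (_+ 1) (*-zeroʳ q) ⟨
    q * 0 + 1                 ∎
    where
    open ≤-Reasoning
    same-θ : ∀ θ θ′ → ¬ δ (u′ · (1# , θ)) (u · (1# , θ)) ≡ 0 → ¬ δ (u′ · (1# , θ′)) (u · (1# , θ′)) ≡ 0 → θ ≡ θ′
    same-θ θ θ′ hit hit′ = collision-unique u′ u u′≢u (δ≢0⇒≡ hit) (δ≢0⇒≡ hit′)

  ∑-collisions≤ : ∀ u → ∑[ u′ ∈ E ] collisions u u′ ≤ q + length E
  ∑-collisions≤ u = begin
    ∑[ u′ ∈ E ] collisions u u′                       ≤⟨ ∑-mono E (λ u′ _ → collisions≤ u u′) ⟩
    ∑[ u′ ∈ E ] (q * Points.δ u′ u + 1)               ≡⟨ ∑-+ E _ _ ⟩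
    ∑[ u′ ∈ E ] (q * Points.δ u′ u) + ∑[ u′ ∈ E ] 1   ≡⟨ cong₂ _+_ (∑-*ˡ E _ q) (trans (∑-const E 1) (*-identityʳ _)) ⟩
    q * ∑[ u′ ∈ E ] Points.δ u′ u + length E           ≤⟨ +-monoˡ-≤ (length E) (*-monoʳ-≤ q (Points.∑-δ≤1 E u E-unique)) ⟩
    q * 1 + length E                                  ≡⟨ cong (_+ length E) (*-identityʳ q) ⟩
    q + length E                                      ∎
    where open ≤-Reasoning

  ∑-energy≤ : ∑[ θ ∈ elements ] energy (1# , θ) ≤ length E * (q + length E)
  ∑-energy≤ = begin
    ∑[ θ ∈ elements ] energy (1# , θ)                              ≡⟨ ∑-cong elements (λ θ → energy≡∑-reps (1# , θ)) ⟩
    ∑[ θ ∈ elements ] ∑[ u ∈ E ] reps (1# , θ) (u · (1# , θ))      ≡⟨ ∑-swap elements E _ ⟩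
    ∑[ u ∈ E ] ∑[ θ ∈ elements ] reps (1# , θ) (u · (1# , θ))      ≡⟨ ∑-cong E (λ u → ∑-swap elements E _) ⟩
    ∑[ u ∈ E ] ∑[ u′ ∈ E ] collisions u u′                         ≤⟨ ∑-mono E (λ u _ → ∑-collisions≤ u) ⟩
    ∑[ u ∈ E ] (q + length E)                                      ≡⟨ ∑-const E (q + length E) ⟩
    length E * (q + length E)                                      ∎
    where open ≤-Reasoning

  ∑-energy-over≤ : ∀ (Θ : List F) → Unique Θ →
    ∑[ θ ∈ Θ ] (q * energy (1# , θ)) ≤ q * (q * length E) + length Θ * (length E * length E)
  ∑-energy-over≤ Θ Θ-unique = +-cancelʳ-≤ (q * M²) _ _ (begin
    ∑[ θ ∈ Θ ] (q * energy (1# , θ)) + q * M²                  ≡⟨ cong (λ n → ∑[ θ ∈ Θ ] (q * energy (1# , θ)) + n * M²) length-elements ⟨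
    ∑[ θ ∈ Θ ] (q * energy (1# , θ)) + length elements * M²    ≤⟨ ∑-sublist+≤ Θ Θ-unique _ M² (λ θ → |E|²≤q*energy (1# , θ)) ⟩
    ∑[ θ ∈ elements ] (q * energy (1# , θ)) + length Θ * M²    ≡⟨ cong (_+ length Θ * M²) (∑-*ˡ elements _ q) ⟩
    q * ∑[ θ ∈ elements ] energy (1# , θ) + length Θ * M²      ≤⟨ +-monoˡ-≤ (length Θ * M²) (*-monoʳ-≤ q ∑-energy≤) ⟩
    q * (M * (q + M)) + length Θ * M²                          ≡⟨ rearrange q M (length Θ) ⟩
    q * (q * M) + length Θ * M² + q * M²                       ∎)
    where
    open ≤-Reasoning
    M M² : ℕ
    M = length E
    M² = M * M
    rearrange : ∀ q M T → q * (M * (q + M)) + T * (M * M) ≡ q * (q * M) + T * (M * M) + q * (M * M)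
    rearrange = solve-∀

image-bound : ∀ q M T N S → M * M ≤ N * S → T * (q * S) ≤ q * (q * M) + T * (M * M) →
              q * (M * T) ≤ N * (q ^ 2 + M * T)
image-bound q zero T N S _ _ = ≤-trans (≤-reflexive (*-zeroʳ q)) z≤n
image-bound q M@(suc _) T N S M²≤NS TqS≤ = *-cancelˡ-≤ M (begin
  M * (q * (M * T))                 ≡⟨ e₁ M q T ⟩
  (T * q) * (M * M)                 ≤⟨ *-monoʳ-≤ (T * q) M²≤NS ⟩
  (T * q) * (N * S)                 ≡⟨ e₂ T q N S ⟩
  N * (T * (q * S))                 ≤⟨ *-monoʳ-≤ N TqS≤ ⟩
  N * (q * (q * M) + T * (M * M))   ≡⟨ e₃ N q M T ⟩
  M * (N * (q ^ 2 + M * T))         ∎)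
  where
  open ≤-Reasoning
  e₁ : ∀ M q T → M * (q * (M * T)) ≡ (T * q) * (M * M)
  e₁ = solve-∀
  e₂ : ∀ T q N S → (T * q) * (N * S) ≡ N * (T * (q * S))
  e₂ = solve-∀
  -- q * (q * 1) is q ^ 2 unfolded: the solver does not recognise Data.Nat._^_.
  e₃ : ∀ N q M T → N * (q * (q * M) + T * (M * M)) ≡ M * (N * (q * (q * 1) + M * T))
  e₃ = solve-∀

image-bound-half : ∀ q a N .{{_ : NonZero q}} → q * a ≤ N * (q ^ 2 + a) → q ^ 2 < a → q < 2 * N
image-bound-half q a N qa≤ q²<a with 2 * N ≤? q
... | no 2N≰q  = ≰⇒> 2N≰q
... | yes 2N≤q = contradiction (begin-strict
  2 * (q * a)           ≤⟨ *-monoʳ-≤ 2 qa≤ ⟩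
  2 * (N * (q ^ 2 + a)) ≡⟨ *-assoc 2 N _ ⟨
  2 * N * (q ^ 2 + a)   ≤⟨ *-monoˡ-≤ _ 2N≤q ⟩
  q * (q ^ 2 + a)       ≡⟨ *-distribˡ-+ q (q ^ 2) a ⟩
  q * q ^ 2 + q * a     <⟨ +-monoˡ-< (q * a) (*-monoʳ-< q q²<a) ⟩
  q * a + q * a         ≡⟨ cong (q * a +_) (+-identityʳ (q * a)) ⟨
  2 * (q * a)           ∎) (<-irrefl refl)
  where open ≤-Reasoning

open FiniteField using (F; 1#; q; dotCard)

corollary1 : (𝔽 : FiniteField) →
  (E : List (F 𝔽 × F 𝔽)) → Unique E →
  (Θ : List (F 𝔽)) → Unique Θ → ¬ (Θ ≡ []) →
  (∃ λ θ → θ ∈ Θ × dotCard 𝔽 E (1# 𝔽 , θ) * (q 𝔽 ^ 2 + length E * length Θ) ≥ q 𝔽 * (length E * length Θ))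
  × (length E * length Θ > q 𝔽 ^ 2 → ∃ λ θ → θ ∈ Θ × 2 * dotCard 𝔽 E (1# 𝔽 , θ) > q 𝔽)
corollary1 𝔽 E E-unique Θ Θ-unique Θ≢[]
  with ∃-below-average Θ (λ θ → q 𝔽 * Energy.energy 𝔽 E E-unique (1# 𝔽 , θ)) Θ≢[]
... | θ , θ∈Θ , θ-below-average =
  (θ , θ∈Θ , bound) , λ large → θ , θ∈Θ , image-bound-half (q 𝔽) (length E * length Θ) N {{q-nonZero}} bound large
  where
  open Elements 𝔽 using (q-nonZero)
  open Energy 𝔽 E E-unique using (energy; |E|²≤dotCard*energy; ∑-energy-over≤)
  v : F 𝔽 × F 𝔽
  v = 1# 𝔽 , θ
  N : ℕ
  N = dotCard 𝔽 E v
  bound : q 𝔽 * (length E * length Θ) ≤ N * (q 𝔽 ^ 2 + length E * length Θ)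
  bound = image-bound (q 𝔽) (length E) (length Θ) N (energy v)
    (|E|²≤dotCard*energy v) (≤-trans θ-below-average (∑-energy-over≤ Θ Θ-unique))
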